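{- Let $k\ge 2$ and $1\le b\le k-1$. For all $n\in\mathbb{N}$, \[ c^{(k)}((0.b);n) = \sum_{i=\max\{n-k+1,0\}}^{n-1} c^{(k)}((0.b);i) + [n=b], \] where an empty sum is $0$.
   Context: Words are over the alphabet $\mathbb{N}=\{0,1,2,\dots\}$; $(x.y)$ denotes the length-2 word with letters $x,y$. For $k\ge 2$, $\phi_k$ is the morphism of $\mathbb{N}^*$ defined for $i\in\mathbb{N}$, $0\le j\le k-1$ by $\phi_k(ki+j)=(ki)(ki+j+1)$ if $0\le j\le k-2$ and $\phi_k(ki+k-1)=ki+k$; $W_n^{(k)}=\phi_k^n(0)$. For a nonempty word $B$, $c^{(k)}(B;n)$ is the number of (possibly overlapping) occurrences of $B$ as a factor of $W_n^{(k)}$. $[P]$ is the Iverson bracket. -}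

module Defs where

open import Data.Nat using (ℕ; zero; suc; _+_; _*_; _∸_; _≤ᵇ_; _≡ᵇ_; NonZero)
open import Data.Nat.DivMod using (_/_; _%_)
open import Data.Bool using (Bool; true; false; if_then_else_; _∧_)
open import Data.List using (List; []; _∷_; concatMap; length)

-- The morphism φ_k on a single letter x = k*i + j (i = x / k, j = x % k):
--   φ_k(x) = (k*i)(x+1)   if j ≤ k-2   (note k*i+j+1 = x+1)
--   φ_k(x) = (x+1)        if j = k-1   (note k*i+k = x+1)
φ-letter : (k : ℕ) → .{{NonZero k}} → ℕ → List ℕ
φ-letter k x =
  if (x % k) ≤ᵇ (k ∸ 2)
  then (k * (x / k)) ∷ suc x ∷ []
  else suc x ∷ []

φ : (k : ℕ) → .{{NonZero k}} → List ℕ → List ℕ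
φ k w = concatMap (φ-letter k) w

W : (k : ℕ) → .{{NonZero k}} → ℕ → List ℕ
W k zero    = 0 ∷ []
W k (suc n) = φ k (W k n)

eqList : List ℕ → List ℕ → Bool
eqList []       []       = true
eqList (x ∷ xs) (y ∷ ys) = (x ≡ᵇ y) ∧ eqList xs ys
eqList _        _        = false

isPrefix : List ℕ → List ℕ → Bool
isPrefix []       _        = true
isPrefix (b ∷ bs) []       = false
isPrefix (b ∷ bs) (x ∷ xs) = (b ≡ᵇ x) ∧ isPrefix bs xs

occ : List ℕ → List ℕ → ℕ
occ B []       = if isPrefix B [] then 1 else 0
occ B (x ∷ xs) = (if isPrefix B (x ∷ xs) then 1 else 0) + occ B xs

c : (k : ℕ) → .{{NonZero k}} → List ℕ → ℕ → ℕ
c k B n = occ B (W k n)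

sumFrom : ℕ → ℕ → (ℕ → ℕ) → ℕ
sumFrom a zero      f = 0
sumFrom a (suc len) f = f a + sumFrom (suc a) len f

-- Σ_{i=lo}^{n-1} f i  (upper bound exclusive: i ranges over lo ≤ i < n),
-- empty (= 0) when n ≤ lo
sumBelow : ℕ → ℕ → (ℕ → ℕ) → ℕ
sumBelow lo n f = sumFrom lo (n ∸ lo) f

iverson-eq : ℕ → ℕ → ℕ
iverson-eq m n = if m ≡ᵇ n then 1 else 0

{-# OPTIONS --safe #-}
module Submission where

-- A letter x < k-1 has image 0(x+1); every other image consists of letters ≥ k.  So in
-- W_{n+1} = φ(W_n) the factors 0b (1 ≤ b ≤ k-1) correspond to the letters b-1 of W_n, each
-- letter 0 to a letter t < k-1 of W_n, and each letter j+1 ≤ k-1 to a letter j.  Hence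
-- c((0.b); n) = c((0.1); n-b+1), and c((0.1); n+2) = |W_{n+1}|_0 = Σ_{t<k-1} |W_n|_t
-- = Σ_{t<k-1} c((0.1); n+1-t): a recurrence of order k-1 whose impulse at n = 1 moves to
-- n = b under the delay by b-1.

open import Defs
open import Data.Nat using (ℕ; zero; suc; _+_; _*_; _∸_; _≤_; _<_; _≤ᵇ_; _≡ᵇ_; z≤n; s≤s; z<s; NonZero; >-nonZero)
open import Data.Nat.Properties
open import Algebra.Properties.CommutativeSemigroup +-commutativeSemigroup using (interchange)
open import Data.Nat.DivMod using (_/_; _%_; m<n⇒m%n≡m; m<n⇒m/n≡0; m≥n⇒m/n>0)
open import Data.Bool using (true; false; T)
open import Data.Bool.Properties using (∧-identityʳ)
open import Data.Empty using (⊥-elim)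
open import Data.List using (List; []; _∷_; _++_)
open import Data.List.Relation.Unary.All as All using (All; []; _∷_)
open import Data.Sum using (inj₁; inj₂)
open import Data.Unit using (tt)
open import Relation.Binary.PropositionalEquality using (_≡_; _≢_; refl; sym; trans; cong; cong₂; subst; module ≡-Reasoning)
open ≡-Reasoning

sum< : ℕ → (ℕ → ℕ) → ℕ
sum< zero    f = 0
sum< (suc l) f = f l + sum< l f

sum<-cong : ∀ l {f g : ℕ → ℕ} → (∀ t → t < l → f t ≡ g t) → sum< l f ≡ sum< l g
sum<-cong zero    f≡g = refl
sum<-cong (suc l) f≡g = cong₂ _+_ (f≡g l ≤-refl) (sum<-cong l (λ t t<l → f≡g t (m<n⇒m<1+n t<l)))

sum<-zero : ∀ l {f : ℕ → ℕ} → (∀ t → f t ≡ 0) → sum< l f ≡ 0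
sum<-zero zero    f≡0 = refl
sum<-zero (suc l) f≡0 = cong₂ _+_ (f≡0 l) (sum<-zero l f≡0)

sum<-distrib-+ : ∀ l (f g : ℕ → ℕ) → sum< l (λ t → f t + g t) ≡ sum< l f + sum< l g
sum<-distrib-+ zero    f g = refl
sum<-distrib-+ (suc l) f g = begin
  (f l + g l) + sum< l (λ t → f t + g t) ≡⟨ cong (f l + g l +_) (sum<-distrib-+ l f g) ⟩
  (f l + g l) + (sum< l f + sum< l g)    ≡⟨ interchange (f l) (g l) (sum< l f) (sum< l g) ⟩
  (f l + sum< l f) + (g l + sum< l g)    ∎

iverson-eq-refl : ∀ n → iverson-eq n n ≡ 1
iverson-eq-refl zero    = refl
iverson-eq-refl (suc n) = iverson-eq-refl n

iverson-eq-≢ : ∀ {m n} → m ≢ n → iverson-eq m n ≡ 0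
iverson-eq-≢ {m} {n} m≢n with m ≡ᵇ n in m≡ᵇn
... | true  = ⊥-elim (m≢n (≡ᵇ⇒≡ m n (subst T (sym m≡ᵇn) tt)))
... | false = refl

iverson-eq-∸ : ∀ j n p → iverson-eq (n ∸ j) (suc p) ≡ iverson-eq n (j + suc p)
iverson-eq-∸ zero    n       p = refl
iverson-eq-∸ (suc j) zero    p = refl
iverson-eq-∸ (suc j) (suc n) p = iverson-eq-∸ j n p

sum<-iverson-≥ : ∀ {l x} → l ≤ x → sum< l (λ t → iverson-eq t x) ≡ 0
sum<-iverson-≥ {zero}  _   = refl
sum<-iverson-≥ {suc l} l<x =
  cong₂ _+_ (iverson-eq-≢ (<⇒≢ l<x)) (sum<-iverson-≥ (<⇒≤ l<x))

sum<-iverson-< : ∀ {l x} → x < l → sum< l (λ t → iverson-eq t x) ≡ 1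
sum<-iverson-< {suc l} {x} x<1+l with m<1+n⇒m<n∨m≡n x<1+l
... | inj₁ x<l  = cong₂ _+_ (iverson-eq-≢ (>⇒≢ x<l)) (sum<-iverson-< x<l)
... | inj₂ refl = cong₂ _+_ (iverson-eq-refl x) (sum<-iverson-≥ {x} ≤-refl)

sumBelow-unfold : ∀ f {lo n} → lo < n → sumBelow lo n f ≡ f lo + sumBelow (suc lo) n f
sumBelow-unfold f {lo} {suc n} (s≤s lo≤n) rewrite +-∸-assoc 1 lo≤n = refl

sumBelow-window-step : ∀ f → f 0 ≡ 0 → ∀ l n →
  sumBelow (n ∸ suc l) n f ≡ f (n ∸ suc l) + sumBelow (n ∸ l) n f
sumBelow-window-step f f0≡0 l n with <-≤-connex l n
sumBelow-window-step f f0≡0 l (suc n) | inj₁ (s≤s l≤n) = begin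
  sumBelow (n ∸ l) (suc n) f                   ≡⟨ sumBelow-unfold f (s≤s (m∸n≤m n l)) ⟩
  f (n ∸ l) + sumBelow (suc (n ∸ l)) (suc n) f ≡⟨ cong (λ lo → f (n ∸ l) + sumBelow lo (suc n) f) (+-∸-assoc 1 l≤n) ⟨
  f (n ∸ l) + sumBelow (suc n ∸ l) (suc n) f   ∎
... | inj₂ n≤l rewrite m≤n⇒m∸n≡0 (m≤n⇒m≤1+n n≤l) | m≤n⇒m∸n≡0 n≤l | f0≡0 = refl

sumBelow-window : ∀ f → f 0 ≡ 0 → ∀ l n → sumBelow (n ∸ l) n f ≡ sum< l (λ t → f (n ∸ suc t))
sumBelow-window f _    zero    n rewrite n∸n≡0 n = refl
sumBelow-window f f0≡0 (suc l) n = trans (sumBelow-window-step f f0≡0 l n)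
  (cong (f (n ∸ suc l) +_) (sumBelow-window f f0≡0 l n))

m∸n∸o≡m∸o∸n : ∀ m n o → m ∸ n ∸ o ≡ m ∸ o ∸ n
m∸n∸o≡m∸o∸n m n o = begin
  m ∸ n ∸ o   ≡⟨ ∸-+-assoc m n o ⟩
  m ∸ (n + o) ≡⟨ cong (m ∸_) (+-comm n o) ⟩
  m ∸ (o + n) ≡⟨ ∸-+-assoc m o n ⟨
  m ∸ o ∸ n   ∎

-- For t ≥ n the term f (n ∸ suc t) is f 0 (truncated subtraction); when f 0 ≡ 0 the sum is
-- the paper's sum over max(n-l, 0) ≤ i < n, see sumBelow-window.
Recurrence : ℕ → ℕ → (ℕ → ℕ) → Set
Recurrence l p f = ∀ n → f n ≡ sum< l (λ t → f (n ∸ suc t)) + iverson-eq n p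

recurrence-delay : ∀ {l p f} j → Recurrence l (suc p) f → Recurrence l (j + suc p) (λ n → f (n ∸ j))
recurrence-delay {l} {p} {f} j rec n = begin
  f (n ∸ j)                                                       ≡⟨ rec (n ∸ j) ⟩
  sum< l (λ t → f (n ∸ j ∸ suc t)) + iverson-eq (n ∸ j) (suc p) ≡⟨ cong₂ _+_ (sum<-cong l λ t _ → cong f (m∸n∸o≡m∸o∸n n j (suc t))) (iverson-eq-∸ j n p) ⟩
  sum< l (λ t → f (n ∸ suc t ∸ j)) + iverson-eq n (j + suc p)   ∎

count : ℕ → List ℕ → ℕ
count a []      = 0
count a (x ∷ w) = iverson-eq a x + count a w

count-++ : ∀ a u v → count a (u ++ v) ≡ count a u + count a v
count-++ a []      v = refl
count-++ a (x ∷ u) v = trans (cong (iverson-eq a x +_) (count-++ a u v)) (sym (+-assoc (iverson-eq a x) _ _))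

count-none : ∀ {a w} → All (a ≢_) w → count a w ≡ 0
count-none []          = refl
count-none (a≢x ∷ a∉w) = cong₂ _+_ (iverson-eq-≢ a≢x) (count-none a∉w)

occ-++-skip : ∀ {B u} v → All (0 ≢_) u → occ (0 ∷ B) (u ++ v) ≡ occ (0 ∷ B) v
occ-++-skip {u = []}        v []        = refl
occ-++-skip {u = zero  ∷ u} v (0≢0 ∷ _) = ⊥-elim (0≢0 refl)
occ-++-skip {u = suc x ∷ u} v (_ ∷ 0∉u) = occ-++-skip v 0∉u

φ-letter-All : ∀ {P : ℕ → Set} k .{{_ : NonZero k}} {x} → P (k * (x / k)) → P (suc x) → All P (φ-letter k x)
φ-letter-All k {x} p q with x % k ≤ᵇ k ∸ 2
... | true  = p ∷ q ∷ []
... | false = q ∷ []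

module Morphism (m : ℕ) where

  k L : ℕ
  k = 2 + m
  L = 1 + m

  φ-letter-small : ∀ {x} → x < L → φ-letter k x ≡ 0 ∷ suc x ∷ []
  φ-letter-small {x} x<L@(s≤s x≤m)
    rewrite m<n⇒m%n≡m (m<n⇒m<1+n x<L) | m<n⇒m/n≡0 (m<n⇒m<1+n x<L) | *-zeroʳ k
    with x ≤ᵇ m | ≤⇒≤ᵇ x≤m
  ... | true | _ = refl

  φ-letter-large : ∀ {x} → L ≤ x → All (L <_) (φ-letter k x)
  φ-letter-large {x} L≤x with <-≤-connex x k
  ... | inj₂ k≤x = φ-letter-All {L <_} k (m≤m*n k (x / k) {{>-nonZero (m≥n⇒m/n>0 k≤x)}}) (s≤s L≤x)
  ... | inj₁ x<k rewrite m<n⇒m%n≡m x<k with x ≤ᵇ m | ≤ᵇ⇒≤ x m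
  ...   | true  | x≤m = ⊥-elim (<⇒≱ L≤x (x≤m tt))
  ...   | false | _   = s≤s L≤x ∷ []

  φ-letter-avoids : ∀ {a x} → a ≤ L → L ≤ x → All (a ≢_) (φ-letter k x)
  φ-letter-avoids a≤L L≤x = All.map (λ L<y → <⇒≢ (≤-<-trans a≤L L<y)) (φ-letter-large L≤x)

  count-φ-letter-zero : ∀ x → count 0 (φ-letter k x) ≡ sum< L (λ t → iverson-eq t x)
  count-φ-letter-zero x with <-≤-connex x L
  ... | inj₁ x<L rewrite φ-letter-small x<L = sym (sum<-iverson-< x<L)
  ... | inj₂ L≤x = trans (count-none (φ-letter-avoids z≤n L≤x)) (sym (sum<-iverson-≥ L≤x))

  count-φ-letter-suc : ∀ {j} → j < L → ∀ x → count (suc j) (φ-letter k x) ≡ iverson-eq j x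
  count-φ-letter-suc j<L x with <-≤-connex x L
  ... | inj₁ x<L rewrite φ-letter-small x<L = +-identityʳ _
  ... | inj₂ L≤x = trans (count-none (φ-letter-avoids j<L L≤x)) (sym (iverson-eq-≢ (<⇒≢ (<-≤-trans j<L L≤x))))

  occ-φ-letter : ∀ {j} → j < L → ∀ x v →
    occ (0 ∷ suc j ∷ []) (φ-letter k x ++ v) ≡ iverson-eq j x + occ (0 ∷ suc j ∷ []) v
  occ-φ-letter {j} j<L x v with <-≤-connex x L
  ... | inj₁ x<L rewrite φ-letter-small x<L | ∧-identityʳ (j ≡ᵇ x) = refl
  ... | inj₂ L≤x = trans (occ-++-skip v (φ-letter-avoids z≤n L≤x))
                         (cong (_+ _) (sym (iverson-eq-≢ (<⇒≢ (<-≤-trans j<L L≤x)))))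

  count-φ-zero : ∀ w → count 0 (φ k w) ≡ sum< L (λ t → count t w)
  count-φ-zero []      = sym (sum<-zero L (λ _ → refl))
  count-φ-zero (x ∷ w) = begin
    count 0 (φ-letter k x ++ φ k w)                           ≡⟨ count-++ 0 (φ-letter k x) (φ k w) ⟩
    count 0 (φ-letter k x) + count 0 (φ k w)                  ≡⟨ cong₂ _+_ (count-φ-letter-zero x) (count-φ-zero w) ⟩
    sum< L (λ t → iverson-eq t x) + sum< L (λ t → count t w) ≡⟨ sum<-distrib-+ L (λ t → iverson-eq t x) (λ t → count t w) ⟨
    sum< L (λ t → count t (x ∷ w))                            ∎

  count-φ-suc : ∀ {j} → j < L → ∀ w → count (suc j) (φ k w) ≡ count j w
  count-φ-suc _   []          = refl
  count-φ-suc {j} j<L (x ∷ w) = begin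
    count (suc j) (φ-letter k x ++ φ k w)                ≡⟨ count-++ (suc j) (φ-letter k x) (φ k w) ⟩
    count (suc j) (φ-letter k x) + count (suc j) (φ k w) ≡⟨ cong₂ _+_ (count-φ-letter-suc j<L x) (count-φ-suc j<L w) ⟩
    count j (x ∷ w)                                      ∎

  occ-φ : ∀ {j} → j < L → ∀ w → occ (0 ∷ suc j ∷ []) (φ k w) ≡ count j w
  occ-φ _       []      = refl
  occ-φ {j} j<L (x ∷ w) = trans (occ-φ-letter j<L x (φ k w)) (cong (iverson-eq j x +_) (occ-φ j<L w))

  c₀ : ℕ → ℕ → ℕ
  c₀ b = c k (0 ∷ b ∷ [])

  c₀-suc : ∀ {j} → j < L → ∀ n → c₀ (suc j) (suc n) ≡ count j (W k n)
  c₀-suc j<L n = occ-φ j<L (W k n)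

  c₀-shift : ∀ {j} → suc j < L → ∀ n → c₀ (suc (suc j)) n ≡ c₀ (suc j) (n ∸ 1)
  c₀-shift _     zero             = refl
  c₀-shift 1+j<L (suc zero)       = c₀-suc 1+j<L 0
  c₀-shift {j} 1+j<L (suc (suc n)) = begin
    c₀ (suc (suc j)) (suc (suc n)) ≡⟨ c₀-suc 1+j<L (suc n) ⟩
    count (suc j) (W k (suc n))    ≡⟨ count-φ-suc (<⇒≤ 1+j<L) (W k n) ⟩
    count j (W k n)                ≡⟨ c₀-suc (<⇒≤ 1+j<L) n ⟨
    c₀ (suc j) (suc n)             ∎

  c₀-delay : ∀ {j} → j < L → ∀ n → c₀ (suc j) n ≡ c₀ 1 (n ∸ j)
  c₀-delay {zero}  _     n = refl
  c₀-delay {suc j} 1+j<L n = begin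
    c₀ (suc (suc j)) n  ≡⟨ c₀-shift 1+j<L n ⟩
    c₀ (suc j) (n ∸ 1)  ≡⟨ c₀-delay (<⇒≤ 1+j<L) (n ∸ 1) ⟩
    c₀ 1 (n ∸ 1 ∸ j)    ≡⟨ cong (c₀ 1) (∸-+-assoc n 1 j) ⟩
    c₀ 1 (n ∸ suc j)    ∎

  c₀-1-recurrence : Recurrence L 1 (c₀ 1)
  c₀-1-recurrence zero          = sym (trans (+-identityʳ _) (sum<-zero L (λ _ → refl)))
  c₀-1-recurrence (suc zero)    = trans (c₀-suc z<s 0) (cong (_+ 1) (sym (sum<-zero L (λ t → cong (c₀ 1) (0∸n≡0 t)))))
  c₀-1-recurrence (suc (suc n)) = begin
    c₀ 1 (suc (suc n))                      ≡⟨ c₀-suc z<s (suc n) ⟩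
    count 0 (W k (suc n))                   ≡⟨ count-φ-zero (W k n) ⟩
    sum< L (λ t → count t (W k n))          ≡⟨ sum<-cong L (λ t t<L → trans (sym (c₀-suc t<L n)) (c₀-delay t<L (suc n))) ⟩
    sum< L (λ t → c₀ 1 (suc n ∸ t))         ≡⟨ +-identityʳ _ ⟨
    sum< L (λ t → c₀ 1 (suc n ∸ t)) + 0     ∎

  c₀-recurrence : ∀ {j} → j < L → Recurrence L (suc j) (c₀ (suc j))
  c₀-recurrence {j} j<L n = begin
    c₀ (suc j) n                                                ≡⟨ c₀-delay j<L n ⟩
    c₀ 1 (n ∸ j)                                                ≡⟨ recurrence-delay j c₀-1-recurrence n ⟩
    sum< L (λ t → c₀ 1 (n ∸ suc t ∸ j)) + iverson-eq n (j + 1) ≡⟨ cong₂ _+_ (sum<-cong L λ t _ → sym (c₀-delay j<L (n ∸ suc t))) (cong (iverson-eq n) (+-comm j 1)) ⟩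
    sum< L (λ t → c₀ (suc j) (n ∸ suc t)) + iverson-eq n (suc j) ∎

lemma5p5 : (k : ℕ) → .{{_ : NonZero k}} → 2 ≤ k → (b : ℕ) → 1 ≤ b → b ≤ k ∸ 1 → (n : ℕ) →
    c k (0 ∷ b ∷ []) n ≡ sumBelow (n ∸ (k ∸ 1)) n (c k (0 ∷ b ∷ [])) + iverson-eq n b
lemma5p5 (suc (suc m)) _ (suc j) _ j<L n = begin
  c₀ (suc j) n                                                 ≡⟨ c₀-recurrence j<L n ⟩
  sum< L (λ t → c₀ (suc j) (n ∸ suc t)) + iverson-eq n (suc j) ≡⟨ cong (_+ iverson-eq n (suc j)) (sumBelow-window (c₀ (suc j)) refl L n) ⟨
  sumBelow (n ∸ L) n (c₀ (suc j)) + iverson-eq n (suc j)      ∎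
  where open Morphism m
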